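{- Let $x=\frac{a}{M}$, where $a\in\mathbb Z$, $M\in\mathbb N$, $M>1$, and $\gcd(a,M)=1$. Then $\mathrm{ord}(x)=1$ if and only if there exists $r\in\{1,2,\ldots,M\}$ such that $\gcd(r,M)=1$ and $a\equiv -r \pmod{M^2}$.
   Context: Let $\chi:\mathbb Q\to\mathbb Q$ be defined by $\chi(x)=x\lceil x\rceil$, where $\lceil x\rceil$ is the smallest integer greater than or equal to $x$. For $x\in\mathbb Q$, the order of $x$ is $\mathrm{ord}(x)=\min\{k\in\mathbb N_0:\chi^k(x)\in\mathbb Z\}$ if this set is nonempty, and $\mathrm{ord}(x)=\infty$ otherwise. Here $\mathbb N=\{1,2,\dots\}$ and $\mathbb N_0=\mathbb N\cup\{0\}$. -}

module Defs where

open import Data.Nat using (ℕ; zero; suc; _<_)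
open import Data.Integer using (ℤ)
open import Data.Rational using (ℚ; _*_; _/_; ceiling)
open import Data.Product using (Σ)
open import Relation.Binary.PropositionalEquality using (_≡_)
open import Relation.Nullary using (¬_)

ι : ℤ → ℚ
ι z = z / 1

IsInt : ℚ → Set
IsInt q = Σ ℤ (λ z → q ≡ ι z)

χ : ℚ → ℚ
χ x = x * ι (ceiling x)

χ^ : ℕ → ℚ → ℚ
χ^ zero x = x
χ^ (suc k) x = χ (χ^ k x)

OrdIs : ℚ → ℕ → Set
OrdIs x k = IsInt (χ^ k x) × (∀ j → j < k → ¬ IsInt (χ^ j x))
  where open import Data.Product using (_×_)

module Submission where

-- Write x = a/M in lowest terms and divide the ceiling out:
-- there is a residue s with 0 ≤ s < M and a + s = ⌈x⌉·M.  Then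
-- χ(x) = a⌈x⌉/M, so (a being prime to M) χ(x) ∈ ℤ iff M ∣ ⌈x⌉ iff
-- M² ∣ a + s.  Since M > 1 the number x itself is not an integer, so
-- ord(x) = 1 iff M² ∣ a + s.  The residue s is the required r: it is
-- nonzero (otherwise M ∣ a) and prime to M (a common divisor of s and M
-- divides a).  Conversely any r ∈ [1, M] with M² ∣ a + r satisfies
-- r ≡ s (mod M) and r ≠ M (again M ∤ a), hence r = s.

open import Defs
open import Data.Nat using (ℕ; _<_; _≤_; _^_; NonZero)
open import Data.Integer using (ℤ; +_; -_; ∣_∣)
open import Data.Integer.Divisibility using (_∣_)
open import Data.Integer.Base using (_+_)
open import Data.Nat.GCD using (gcd)
open import Data.Rational using (_/_)
open import Data.Product using (Σ; _×_)
open import Relation.Binary.PropositionalEquality using (_≡_)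
open import Function.Bundles using (_⇔_)

open import Data.Nat using (zero; suc; z≤n; s≤s)
import Data.Nat as ℕ
import Data.Nat.Properties as ℕP
import Data.Nat.Divisibility as ℕD
import Data.Nat.Coprimality as ℕC
import Data.Nat.GCD as ℕG
import Data.Integer as ℤ
import Data.Integer.Properties as ℤP
import Data.Integer.DivMod as ℤDM
import Data.Integer.Divisibility.Signed as ℤS
open import Data.Integer.Tactic.RingSolver using (solve-∀)
import Data.Rational as Q
import Data.Rational.Properties as QP
import Data.Rational.Unnormalised as U
import Data.Rational.Unnormalised.Properties as UP
open import Data.Product using (_,_; proj₁; proj₂)
open import Function.Bundles using (mk⇔; Equivalence)
open import Function using (_∘′_)
open import Relation.Binary.PropositionalEquality
  using (refl; sym; trans; cong; subst; subst₂; module ≡-Reasoning)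
open import Relation.Nullary using (¬_; yes; no)
open import Data.Empty using (⊥-elim)

isInt⇔divides : ∀ (p : Q.ℚ) (N : ℤ) (d : ℕ) →
                Q.toℚᵘ p U.≃ U.mkℚᵘ N d → (IsInt p ⇔ (+ suc d) ∣ N)
isInt⇔divides p N d p≃N/d = mk⇔ to from
  where
  ι≃ : ∀ z → Q.toℚᵘ (ι z) U.≃ U.mkℚᵘ z 0
  ι≃ z = QP.toℚᵘ-fromℚᵘ (U.mkℚᵘ z 0)

  to : IsInt p → (+ suc d) ∣ N
  to (z , p≡z) = ℤS.∣⇒∣ᵤ (ℤS.divides z (trans (sym (ℤP.*-identityʳ N)) cross))
    where
    cross : N ℤ.* + 1 ≡ z ℤ.* + suc d
    cross = UP.drop-*≡* (UP.≃-trans (UP.≃-sym p≃N/d)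
                          (UP.≃-trans (QP.toℚᵘ-cong p≡z) (ι≃ z)))

  from : (+ suc d) ∣ N → IsInt p
  from dvd with ℤS.∣ᵤ⇒∣ dvd
  ... | ℤS.divides z N≡z*D = z , QP.toℚᵘ-injective
          (UP.≃-trans p≃N/d (UP.≃-trans N/d≃z (UP.≃-sym (ι≃ z))))
    where
    N/d≃z : U.mkℚᵘ N d U.≃ U.mkℚᵘ z 0
    N/d≃z = U.*≡* (trans (ℤP.*-identityʳ N) N≡z*D)

-- Division identity for the ceiling: ↥p + s = ⌈p⌉ · ↧p with 0 ≤ s < ↧p.
-- It follows from ⌈p⌉ = -⌊-p⌋ and Euclidean division of -↥p by ↧p.
ceiling-residue : ∀ p → Σ ℕ λ s → s < Q.↧ₙ p × Q.↥ p ℤ.+ + s ≡ Q.ceiling p ℤ.* Q.↧ p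
ceiling-residue p@(Q.mkℚ n _ _) = (ℤ.- n) ℤ.% D , ℤDM.n%d<d (ℤ.- n) D ,
  subst (λ c → n ℤ.+ + ((ℤ.- n) ℤ.% D) ≡ c ℤ.* D) (sym (ceiling≡ p)) division
  where
  D = Q.↧ p

  ceiling≡ : ∀ p → Q.ceiling p ≡ ℤ.- ((ℤ.- Q.↥ p) ℤ./ Q.↧ p)
  ceiling≡ (Q.mkℚ (+ zero) _ _) = refl
  ceiling≡ (Q.mkℚ (+ suc _) _ _) = refl
  ceiling≡ (Q.mkℚ ℤ.-[1+ _ ] _ _) = refl

  negate-division : ∀ (s k D : ℤ) → ℤ.- (s ℤ.+ k ℤ.* D) ℤ.+ s ≡ (ℤ.- k) ℤ.* D
  negate-division = solve-∀

  division : n ℤ.+ + ((ℤ.- n) ℤ.% D) ≡ (ℤ.- ((ℤ.- n) ℤ./ D)) ℤ.* D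
  division = begin
      n ℤ.+ + s                       ≡⟨ cong (ℤ._+ + s) (sym (ℤP.neg-involutive n)) ⟩
      ℤ.- (ℤ.- n) ℤ.+ + s             ≡⟨ cong (λ x → ℤ.- x ℤ.+ + s) (ℤDM.a≡a%n+[a/n]*n (ℤ.- n) D) ⟩
      ℤ.- (+ s ℤ.+ k ℤ.* D) ℤ.+ + s   ≡⟨ negate-division (+ s) k D ⟩
      (ℤ.- k) ℤ.* D                   ∎
    where
    open ≡-Reasoning
    s = (ℤ.- n) ℤ.% D
    k = (ℤ.- n) ℤ./ D

residue-unique : ∀ {M r s} → (+ M) ℤS.∣ (+ r ℤ.- + s) → r < M → s < M → r ≡ s
residue-unique {M} {r} {s} M∣r-s r<M s<M =
  ℤP.+-injective (ℤP.i-j≡0⇒i≡j (+ r) (+ s) (ℤP.∣i∣≡0⇒i≡0 ∣r-s∣≡0))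
  where
  ∣r-s∣<M : ∣ + r ℤ.- + s ∣ < M
  ∣r-s∣<M = subst (_< M) (cong ∣_∣ (sym (ℤP.m-n≡m⊖n r s)))
              (ℕP.≤-<-trans (ℤP.∣m⊝n∣≤m⊔n r s) (ℕP.⊔-lub r<M s<M))

  ∣r-s∣≡0 : ∣ + r ℤ.- + s ∣ ≡ 0
  ∣r-s∣≡0 with ∣ + r ℤ.- + s ∣ in eq
  ... | zero  = refl
  ... | suc _ = ⊥-elim (ℕP.<-irrefl refl
                  (ℕP.<-≤-trans (subst (_< M) eq ∣r-s∣<M)
                    (ℕD.∣⇒≤ (subst (M ℕD.∣_) eq (ℤS.∣⇒∣ᵤ M∣r-s)))))

module Fraction (a : ℤ) (m : ℕ) (1<M : 1 < suc m) (a⊥M : gcd ∣ a ∣ (suc m) ≡ 1) where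

  M : ℕ
  M = suc m

  x : Q.ℚ
  x = a / M

  -- Since a/M is already reduced, its numerator and denominator are a and M.
  ↥x≡a : Q.↥ x ≡ a
  ↥x≡a = trans (sym (ℤP.*-identityʳ _))
           (subst (λ g → Q.↥ x ℤ.* g ≡ a) (cong +_ a⊥M) (QP.↥-/ a M))

  ↧x≡M : Q.↧ x ≡ + M
  ↧x≡M = trans (sym (ℤP.*-identityʳ _))
           (subst (λ g → Q.↧ x ℤ.* g ≡ + M) (cong +_ a⊥M) (QP.↧-/ a M))

  -- M does not divide a: it would divide gcd(a, M) = 1, contradicting M > 1.
  M∤a : ¬ M ℕD.∣ ∣ a ∣
  M∤a M∣a = ℕP.<-irrefl refl (subst (1 <_) M≡1 1<M)
    where
    M≡1 : M ≡ 1
    M≡1 = ℕD.∣1⇒≡1 (subst (M ℕD.∣_) a⊥M (ℕG.gcd-greatest M∣a ℕD.∣-refl))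

  x-not-int : ¬ IsInt x
  x-not-int = M∤a ∘′ Equivalence.to (isInt⇔divides x a m (QP.toℚᵘ-fromℚᵘ (U.mkℚᵘ a m)))

  c : ℤ
  c = Q.ceiling x

  s : ℕ
  s = proj₁ (ceiling-residue x)

  s<M : s < M
  s<M = subst (s <_) (cong ∣_∣ ↧x≡M) (proj₁ (proj₂ (ceiling-residue x)))

  a+s≡cM : a ℤ.+ + s ≡ c ℤ.* + M
  a+s≡cM = subst₂ (λ n d → n ℤ.+ + s ≡ c ℤ.* d) ↥x≡a ↧x≡M (proj₂ (proj₂ (ceiling-residue x)))

  ∣a+s∣≡∣c∣M : ∣ a ℤ.+ + s ∣ ≡ ∣ c ∣ ℕ.* M
  ∣a+s∣≡∣c∣M = trans (cong ∣_∣ a+s≡cM) (ℤP.abs-* c (+ M))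

  M²≡M*M : M ^ 2 ≡ M ℕ.* M
  M²≡M*M = cong (M ℕ.*_) (ℕP.*-identityʳ M)

  -- χ(x) = a⌈x⌉/M is an integer iff M ∣ a⌈x⌉ iff (a ⊥ M) M ∣ ⌈x⌉
  -- iff M² ∣ ⌈x⌉ · M = a + s.
  χx-int⇔ : IsInt (χ x) ⇔ (M ^ 2) ℕD.∣ ∣ a ℤ.+ + s ∣
  χx-int⇔ = mk⇔ (M∣c⇒M² ∘′ M∣ac⇒M∣c ∘′ Equivalence.to int⇔M∣ac)
                (Equivalence.from int⇔M∣ac ∘′ M∣c⇒M∣ac ∘′ M²⇒M∣c)
    where
    χx≃ac/M : Q.toℚᵘ (χ x) U.≃ U.mkℚᵘ (a ℤ.* c) m
    χx≃ac/M = UP.≃-trans (QP.toℚᵘ-homo-* x (ι c))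
      (UP.≃-trans (UP.*-cong (QP.toℚᵘ-fromℚᵘ (U.mkℚᵘ a m)) (QP.toℚᵘ-fromℚᵘ (U.mkℚᵘ c 0)))
                  (UP.≃-reflexive (cong (U.mkℚᵘ (a ℤ.* c)) (ℕP.*-identityʳ m))))

    int⇔M∣ac : IsInt (χ x) ⇔ M ℕD.∣ ∣ a ℤ.* c ∣
    int⇔M∣ac = isInt⇔divides (χ x) (a ℤ.* c) m χx≃ac/M

    M∣ac⇒M∣c : M ℕD.∣ ∣ a ℤ.* c ∣ → M ℕD.∣ ∣ c ∣
    M∣ac⇒M∣c M∣ac = ℕC.coprime-divisor {n = ∣ a ∣} (ℕC.sym (ℕC.gcd≡1⇒coprime a⊥M))
                      (subst (M ℕD.∣_) (ℤP.abs-* a c) M∣ac)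

    M∣c⇒M∣ac : M ℕD.∣ ∣ c ∣ → M ℕD.∣ ∣ a ℤ.* c ∣
    M∣c⇒M∣ac M∣c = subst (M ℕD.∣_) (sym (ℤP.abs-* a c)) (ℕD.∣-trans M∣c (ℕD.n∣m*n ∣ a ∣))

    M∣c⇒M² : M ℕD.∣ ∣ c ∣ → (M ^ 2) ℕD.∣ ∣ a ℤ.+ + s ∣
    M∣c⇒M² M∣c = subst₂ ℕD._∣_ (sym M²≡M*M) (sym ∣a+s∣≡∣c∣M) (ℕD.*-monoˡ-∣ M M∣c)

    M²⇒M∣c : (M ^ 2) ℕD.∣ ∣ a ℤ.+ + s ∣ → M ℕD.∣ ∣ c ∣
    M²⇒M∣c M²∣ = ℕD.*-cancelʳ-∣ M (subst₂ ℕD._∣_ M²≡M*M ∣a+s∣≡∣c∣M M²∣)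

  -- s ≠ 0, for otherwise a = ⌈x⌉ · M.
  1≤s : 1 ≤ s
  1≤s with s in s≡
  ... | suc _ = s≤s z≤n
  ... | zero  = ⊥-elim (M∤a (ℕD.divides ∣ c ∣ ∣a∣≡∣c∣M))
    where
    ∣a∣≡∣c∣M : ∣ a ∣ ≡ ∣ c ∣ ℕ.* M
    ∣a∣≡∣c∣M = trans (cong ∣_∣ (trans (sym (ℤP.+-identityʳ a)) (cong (λ t → a ℤ.+ + t) (sym s≡))))
                     ∣a+s∣≡∣c∣M

  -- gcd(s, M) divides s and ⌈x⌉ · M = a + s, hence a, hence gcd(a, M) = 1.
  s⊥M : gcd s M ≡ 1
  s⊥M = ℕD.∣1⇒≡1 (subst (g ℕD.∣_) a⊥M (ℕG.gcd-greatest (ℤS.∣⇒∣ᵤ g∣a) (ℕG.gcd[m,n]∣n s M)))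
    where
    g = gcd s M
    g∣a : (+ g) ℤS.∣ a
    g∣a = ℤS.∣m+n∣n⇒∣m
            (subst ((+ g) ℤS.∣_) (sym a+s≡cM) (ℤS.∣n⇒∣m*n c (ℤS.∣ᵤ⇒∣ (ℕG.gcd[m,n]∣n s M))))
            (ℤS.∣ᵤ⇒∣ (ℕG.gcd[m,n]∣m s M))

  -- Any r ≤ M with M² ∣ a + r is the residue s: r ≡ -a ≡ s (mod M), and
  -- r = M is excluded because M ∤ a.
  residue-is-s : ∀ {r} → r ≤ M → (M ^ 2) ℕD.∣ ∣ a ℤ.+ + r ∣ → r ≡ s
  residue-is-s {r} r≤M M²∣a+r = residue-unique M∣r-s r<M s<M
    where
    M∣a+r : (+ M) ℤS.∣ (a ℤ.+ + r)
    M∣a+r = ℤS.∣ᵤ⇒∣ (ℕD.∣-trans (ℕD.m∣m*n (M ℕ.* 1)) M²∣a+r)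

    M∣a+s : (+ M) ℤS.∣ (a ℤ.+ + s)
    M∣a+s = subst ((+ M) ℤS.∣_) (sym a+s≡cM) (ℤS.∣n⇒∣m*n c ℤS.∣-refl)

    cancel-a : ∀ (a r s : ℤ) → (a ℤ.+ r) ℤ.- (a ℤ.+ s) ≡ r ℤ.- s
    cancel-a = solve-∀

    M∣r-s : (+ M) ℤS.∣ (+ r ℤ.- + s)
    M∣r-s = subst ((+ M) ℤS.∣_) (cancel-a a (+ r) (+ s)) (ℤS.∣m∣n⇒∣m-n M∣a+r M∣a+s)

    r<M : r < M
    r<M with r ℕ.≟ M
    ... | no r≢M  = ℕP.≤∧≢⇒< r≤M r≢M
    ... | yes refl = ⊥-elim (M∤a (ℤS.∣⇒∣ᵤ (ℤS.∣m+n∣n⇒∣m {m = a} M∣a+r ℤS.∣-refl)))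

  -- ord(x) = 1 means exactly that χ(x) is an integer, since x is not one.
  ord1⇔χx-int : OrdIs x 1 ⇔ IsInt (χ x)
  ord1⇔χx-int = mk⇔ (λ (χx-int , _) → χx-int) (λ χx-int → χx-int , below-1)
    where
    below-1 : ∀ j → j < 1 → ¬ IsInt (χ^ j x)
    below-1 zero    _         = x-not-int
    below-1 (suc _) (s≤s ())

lemma2p1 : (a : ℤ) (M : ℕ) .{{_ : NonZero M}} → 1 < M → gcd ∣ a ∣ M ≡ 1 →
    (OrdIs (a / M) 1
      ⇔ Σ ℕ (λ r → (1 ≤ r × r ≤ M) × (gcd r M ≡ 1 × (+ (M ^ 2)) ∣ (a + (+ r)))))
lemma2p1 a (suc m) 1<M a⊥M = mk⇔ to from
  where
  open Fraction a m 1<M a⊥M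

  Residue : Set
  Residue = Σ ℕ (λ r → (1 ≤ r × r ≤ M) × (gcd r M ≡ 1 × (+ (M ^ 2)) ∣ (a + (+ r))))

  to : OrdIs x 1 → Residue
  to ord1 = s , (1≤s , ℕP.<⇒≤ s<M) , s⊥M ,
            Equivalence.to χx-int⇔ (Equivalence.to ord1⇔χx-int ord1)

  from : Residue → OrdIs x 1
  from (r , (_ , r≤M) , (_ , M²∣a+r)) = Equivalence.from ord1⇔χx-int
    (Equivalence.from χx-int⇔ (subst (λ t → (M ^ 2) ℕD.∣ ∣ a ℤ.+ + t ∣) (residue-is-s r≤M M²∣a+r) M²∣a+r))
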